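{- Let $S=\{s_1,\dots,s_n\}$ and let $\mathcal{C}=\{C_1,\dots,C_k\}$ be linearly ordered by $\sigma$ with $C_1\prec_\sigma C_2\prec_\sigma\dots\prec_\sigma C_k$. Let $a_1,\dots,a_k$ be non-negative integers with $\sum_{i=1}^k a_i=n$, for $t:S\to\mathcal{C}$ write $a_i(t)=|\{s\in S: t(s)=C_i\}|$, and let $\mathcal{T}=\{(t_1,t_2): t_1,t_2:S\to\mathcal{C},\ a_i(t_1)=a_i \text{ for all } i\}$. Then $$ecr(S,\mathcal{C},\mathcal{T},\sigma)=\tfrac12\sum_{i=1}^k a_i(n-a_i),$$ and this maximum is achieved by a pair $(t_1,t_2)\in\mathcal{T}$ with $a_i(t_1)=a_{k-i+1}(t_2)$ for all $i$.
   Context: For tests $t_1,t_2:S\to\mathcal{C}$, a combinatorial layout is a pair of linear orders $\pi_1,\pi_2$ of $S$ such that $t_j(s)\prec_\sigma t_j(s')$ implies $s$ precedes $s'$ in $\pi_j$ ($j=1,2$). Its number of crossings is the number of unordered pairs $\{s,s'\}$ whose relative order differs in $\pi_1$ and $\pi_2$. The panel crossing number $pcr(S,\mathcal{C},(t_1,t_2),\sigma)$ is the minimum number of crossings over all combinatorial layouts. For a set $\mathcal{T}$ of test sequences, $ecr(S,\mathcal{C},\mathcal{T},\sigma)=\max\{pcr(S,\mathcal{C},T,\sigma): T\in\mathcal{T}\}$. -}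

module Defs where

open import Data.Nat using (ℕ; zero; suc; _+_; _*_; _∸_; _≤_)
open import Data.Fin using (Fin; _<_; _<?_; _≟_; opposite)
open import Data.Fin.Permutation using (Permutation′; _⟨$⟩ʳ_)
open import Data.List using (List; map; allFin)
open import Data.Nat.ListAction using (sum)
open import Data.Product using (Σ; _×_; _,_; ∃; ∃-syntax)
open import Relation.Nullary using (yes; no)
open import Relation.Binary.PropositionalEquality using (_≡_)

∑ : {n : ℕ} → (Fin n → ℕ) → ℕ
∑ {n} f = sum (map f (allFin n))

-- Elements S = Fin n, categories 𝒞 = Fin k, σ is the natural order on Fin k
-- (C_1 ≺ ... ≺ C_k). A test is a map S → 𝒞.
Test : ℕ → ℕ → Set
Test n k = Fin n → Fin k

-- A linear order of S = Fin n is given by a bijection π : S → Fin n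
-- (π s = position of s); s precedes s' iff π s < π s'.
LinOrder : ℕ → Set
LinOrder n = Permutation′ n

_precedes_under_ : {n : ℕ} → Fin n → Fin n → LinOrder n → Set
s precedes s' under π = (π ⟨$⟩ʳ s) < (π ⟨$⟩ʳ s')

Respects : {n k : ℕ} → Test n k → LinOrder n → Set
Respects t π = ∀ s s' → t s < t s' → s precedes s' under π

record Layout {n k : ℕ} (t₁ t₂ : Test n k) : Set where
  field
    π₁ : LinOrder n
    π₂ : LinOrder n
    resp₁ : Respects t₁ π₁
    resp₂ : Respects t₂ π₂
open Layout public

-- Indicator: s before s' in π₁ but s' before s in π₂.
-- Each unordered pair with differing relative order is counted exactly once.
crossInd : {n : ℕ} → LinOrder n → LinOrder n → Fin n → Fin n → ℕ
crossInd π₁ π₂ s s' with (π₁ ⟨$⟩ʳ s) <? (π₁ ⟨$⟩ʳ s') | (π₂ ⟨$⟩ʳ s') <? (π₂ ⟨$⟩ʳ s)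
... | yes _ | yes _ = 1
... | _     | _     = 0

crossings : {n k : ℕ} {t₁ t₂ : Test n k} → Layout t₁ t₂ → ℕ
crossings L = ∑ λ s → ∑ λ s' → crossInd (π₁ L) (π₂ L) s s'

IsPcr : {n k : ℕ} → Test n k → Test n k → ℕ → Set
IsPcr t₁ t₂ m = (Σ (Layout t₁ t₂) λ L → crossings L ≡ m)
              × (∀ (L : Layout t₁ t₂) → m ≤ crossings L)

IsEcr : {n k : ℕ} → (Test n k → Test n k → Set) → ℕ → Set
IsEcr {n} {k} 𝒯 m =
    (Σ (Test n k) λ t₁ → Σ (Test n k) λ t₂ → 𝒯 t₁ t₂ × IsPcr t₁ t₂ m)
  × (∀ (t₁ t₂ : Test n k) → 𝒯 t₁ t₂ → ∀ p → IsPcr t₁ t₂ p → p ≤ m)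

indEq : {k : ℕ} → Fin k → Fin k → ℕ
indEq i j with i ≟ j
... | yes _ = 1
... | no _  = 0

count : {n k : ℕ} → Test n k → Fin k → ℕ
count t i = ∑ λ s → indEq (t s) i

InT : {n k : ℕ} → (Fin k → ℕ) → Test n k → Test n k → Set
InT a t₁ t₂ = ∀ i → count t₁ i ≡ a i

-- Let D t = separatedPairs t count the ordered pairs (s , s') with t s < t s'. Every layout of
-- (t , opposite ∘ t) reverses all of these pairs, while a suitably sorted layout of any (t₁ , t₂)
-- crosses no other pairs; hence pcr (t₁ , t₂) ≤ D t₁, with equality when t₂ = opposite ∘ t₁. Since each
-- ordered pair is separated by t one way, the other way, or lies in a single class,
-- 2 D t + ∑ aᵢ² = n², so D t depends only on the class sizes and equals ½ ∑ aᵢ (n − aᵢ).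

module Submission where

open import Defs
import Data.Nat as ℕ
open import Data.Nat using (ℕ; zero; suc; _+_; _*_; _∸_; _≤_; z≤n; z<s; s<s)
open import Data.Nat.Properties
  using (+-*-semiring; +-assoc; +-identityʳ; *-identityˡ; *-identityʳ; *-zeroʳ; *-distribˡ-+
        ; +-cancelʳ-≡; *-cancelˡ-≡; +-mono-≤; m≤m+n; m∸n+n≡m; ∸-monoʳ-<
        ; <⇒≱; ≤-reflexive; ≤-trans; ≤-antisym)
open import Data.Fin using (Fin; zero; suc; punchIn; punchOut; _↑ˡ_; _↑ʳ_; _<_; _<?_; _≟_; opposite)
open import Data.Fin.Properties
  using (suc-injective; punchInᵢ≢i; punchIn-punchOut; toℕ<n; opposite-prop; opposite-involutive
        ; <-asym; <-irrefl; <-cmp; ≤∧≢⇒<; ≤-decTotalOrder)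
open import Data.Fin.Permutation using (Permutation; Permutation′; _⟨$⟩ʳ_; insert; insert-punchIn)
import Data.Fin.Permutation as Perm
open import Data.List using (map; allFin; tabulate)
open import Data.List.Properties using (map-tabulate)
import Data.Nat.ListAction as List
open import Data.Vec.Functional using (_++_)
open import Data.Vec.Functional.Properties using (lookup-++ˡ; lookup-++ʳ)
open import Data.Product using (Σ; ∃; _×_; _,_; proj₁; proj₂; uncurry)
open import Data.Product.Relation.Binary.Lex.NonStrict using (×-decTotalOrder)
open import Data.Sum using (_⊎_; inj₁; inj₂)
import Data.List.Relation.Unary.All as All
open import Data.List.Membership.Propositional.Properties using (∈-allFin)
open import Relation.Binary.Bundles using (DecTotalOrder)
open import Function using (_∘_; id)
open import Relation.Binary.PropositionalEquality hiding (resp₂)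
open import Relation.Nullary using (¬_; yes; no; contradiction)
open import Relation.Binary.Definitions using (tri<; tri≈; tri>)
open import Function.Definitions using (Injective)
import Algebra.Properties.Semiring.Sum +-*-semiring as Sum

private
  variable
    k m n : ℕ

∑≡sum : (f : Fin n → ℕ) → ∑ f ≡ Sum.sum f
∑≡sum {zero} f = refl
∑≡sum {suc n} f = cong (f zero +_) (trans (cong List.sum tabulate-suc) (∑≡sum (f ∘ suc)))
  where
  tabulate-suc : map f (tabulate suc) ≡ map (f ∘ suc) (allFin n)
  tabulate-suc = trans (map-tabulate suc f) (sym (map-tabulate id (f ∘ suc)))

∑-suc : (f : Fin (suc n) → ℕ) → ∑ f ≡ f zero + ∑ (f ∘ suc)
∑-suc f = trans (∑≡sum f) (cong (f zero +_) (sym (∑≡sum (f ∘ suc))))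

∑-cong : {f g : Fin n → ℕ} → (∀ i → f i ≡ g i) → ∑ f ≡ ∑ g
∑-cong {f = f} {g} f≗g = trans (∑≡sum f) (trans (Sum.sum-cong-≗ f≗g) (sym (∑≡sum g)))

∑-mono : {f g : Fin n → ℕ} → (∀ i → f i ≤ g i) → ∑ f ≤ ∑ g
∑-mono {zero}  f≤g = z≤n
∑-mono {suc n} {f} {g} f≤g =
  subst₂ _≤_ (sym (∑-suc f)) (sym (∑-suc g)) (+-mono-≤ (f≤g zero) (∑-mono (f≤g ∘ suc)))

∑-distrib-+ : (f g : Fin n → ℕ) → ∑ (λ i → f i + g i) ≡ ∑ f + ∑ g
∑-distrib-+ f g = trans (∑≡sum (λ i → f i + g i))
  (trans (Sum.∑-distrib-+ f g) (sym (cong₂ _+_ (∑≡sum f) (∑≡sum g))))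

∑-distribʳ-* : (f : Fin n → ℕ) (c : ℕ) → ∑ f * c ≡ ∑ (λ i → f i * c)
∑-distribʳ-* f c = trans (cong (_* c) (∑≡sum f)) (trans (Sum.*-distribʳ-sum c f) (sym (∑≡sum (λ i → f i * c))))

∑-comm : (h : Fin m → Fin n → ℕ) → ∑ (λ i → ∑ (h i)) ≡ ∑ (λ j → ∑ (λ i → h i j))
∑-comm h = begin
  ∑ (λ i → ∑ (h i))                  ≡⟨ ∑-cong (∑≡sum ∘ h) ⟩
  ∑ (λ i → Sum.sum (h i))            ≡⟨ ∑≡sum (λ i → Sum.sum (h i)) ⟩
  Sum.sum (λ i → Sum.sum (h i))      ≡⟨ Sum.∑-comm h ⟩
  Sum.sum (λ j → Sum.sum (λ i → h i j)) ≡⟨ ∑≡sum (λ j → Sum.sum (λ i → h i j)) ⟨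
  ∑ (λ j → Sum.sum (λ i → h i j))    ≡⟨ ∑-cong (λ j → ∑≡sum (λ i → h i j)) ⟨
  ∑ (λ j → ∑ (λ i → h i j))          ∎
  where open ≡-Reasoning

∑-const : (c : ℕ) → ∑ {n} (λ _ → c) ≡ n * c
∑-const {zero}  c = refl
∑-const {suc n} c = trans (∑-suc {n} (λ _ → c)) (cong (c +_) (∑-const {n} c))

∑-remove : (f : Fin (suc n) → ℕ) (i : Fin (suc n)) → ∑ f ≡ f i + ∑ (f ∘ punchIn i)
∑-remove f i = trans (∑≡sum f) (trans (Sum.sum-remove {i = i} f) (cong (f i +_) (sym (∑≡sum (f ∘ punchIn i)))))

≤-∑ : (f : Fin n → ℕ) (i : Fin n) → f i ≤ ∑ f
≤-∑ {suc n} f i = subst (f i ≤_) (sym (∑-remove f i)) (m≤m+n (f i) _)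

∑-single : (f : Fin n → ℕ) (i : Fin n) → (∀ j → j ≢ i → f j ≡ 0) → ∑ f ≡ f i
∑-single {suc n} f i f≡0 = begin
  ∑ f                          ≡⟨ ∑-remove f i ⟩
  f i + ∑ (f ∘ punchIn i)      ≡⟨ cong (f i +_) (∑-cong (λ j → f≡0 (punchIn i j) (punchInᵢ≢i i j))) ⟩
  f i + ∑ {n} (λ _ → 0)        ≡⟨ cong (f i +_) (trans (∑-const {n} 0) (*-zeroʳ n)) ⟩
  f i + 0                      ≡⟨ +-identityʳ (f i) ⟩
  f i                          ∎
  where open ≡-Reasoning

∑-splitAt : (f : Fin (m + n) → ℕ) → ∑ f ≡ ∑ (f ∘ (_↑ˡ n)) + ∑ (f ∘ (m ↑ʳ_))
∑-splitAt {zero}  f = refl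
∑-splitAt {suc m} {n} f = begin
  ∑ f                                                      ≡⟨ ∑-suc f ⟩
  f zero + ∑ (f ∘ suc)                                     ≡⟨ cong (f zero +_) (∑-splitAt {m} (f ∘ suc)) ⟩
  f zero + (∑ (f ∘ suc ∘ (_↑ˡ n)) + ∑ (f ∘ (suc m ↑ʳ_)))   ≡⟨ +-assoc (f zero) _ _ ⟨
  f zero + ∑ (f ∘ suc ∘ (_↑ˡ n)) + ∑ (f ∘ (suc m ↑ʳ_))
    ≡⟨ cong (_+ ∑ (f ∘ (suc m ↑ʳ_))) (∑-suc (f ∘ (_↑ˡ n))) ⟨
  ∑ (f ∘ (_↑ˡ n)) + ∑ (f ∘ (suc m ↑ʳ_))                    ∎
  where open ≡-Reasoning

indLt : Fin k → Fin k → ℕ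
indLt i j with i <? j
... | yes _ = 1
... | no  _ = 0

indEq-refl : (i : Fin k) → indEq i i ≡ 1
indEq-refl i with i ≟ i
... | yes _   = refl
... | no  i≢i = contradiction refl i≢i

indEq-≢ : {i j : Fin k} → i ≢ j → indEq i j ≡ 0
indEq-≢ {i = i} {j} i≢j with i ≟ j
... | yes i≡j = contradiction i≡j i≢j
... | no  _   = refl

indEq-injective : (f : Fin k → Fin m) → Injective _≡_ _≡_ f → (i j : Fin k) → indEq (f i) (f j) ≡ indEq i j
indEq-injective f f-inj i j with i ≟ j
... | yes refl = indEq-refl (f i)
... | no  i≢j  = indEq-≢ (i≢j ∘ f-inj)

indLt-trichotomy : (i j : Fin k) → indLt i j + indLt j i + indEq j i ≡ 1
indLt-trichotomy i j with i <? j | j <? i | j ≟ i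
... | yes i<j | yes j<i | _        = contradiction j<i (<-asym i<j)
... | yes i<j | no  _   | yes refl = contradiction i<j (<-irrefl refl)
... | yes _   | no  _   | no  _    = refl
... | no  _   | yes j<i | yes refl = contradiction j<i (<-irrefl refl)
... | no  _   | yes _   | no  _    = refl
... | no  _   | no  _   | yes _    = refl
... | no  i≮j | no  j≮i | no  j≢i with <-cmp i j
...   | tri< i<j _ _ = contradiction i<j i≮j
...   | tri≈ _ i≡j _ = contradiction (sym i≡j) j≢i
...   | tri> _ _ j<i = contradiction j<i j≮i

indLt-< : {i j : Fin k} → i < j → indLt i j ≡ 1
indLt-< {i = i} {j} i<j with i <? j
... | yes _   = refl
... | no  i≮j = contradiction i<j i≮j

∑-distrib-+₃ : (f g h : Fin n → ℕ) → ∑ (λ i → f i + g i + h i) ≡ ∑ f + ∑ g + ∑ h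
∑-distrib-+₃ f g h = trans (∑-distrib-+ (λ i → f i + g i) h) (cong (_+ ∑ h) (∑-distrib-+ f g))

∑-fibres : (t : Test n k) (g : Fin k → ℕ) → ∑ (g ∘ t) ≡ ∑ (λ i → count t i * g i)
∑-fibres t g = begin
  ∑ (g ∘ t)                                 ≡⟨ ∑-cong (λ s → select (t s)) ⟨
  ∑ (λ s → ∑ (λ i → indEq (t s) i * g i))   ≡⟨ ∑-comm (λ s i → indEq (t s) i * g i) ⟩
  ∑ (λ i → ∑ (λ s → indEq (t s) i * g i))   ≡⟨ ∑-cong (λ i → ∑-distribʳ-* (λ s → indEq (t s) i) (g i)) ⟨
  ∑ (λ i → count t i * g i)                 ∎
  where
  open ≡-Reasoning
  select : ∀ j → ∑ (λ i → indEq j i * g i) ≡ g j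
  select j = begin
    ∑ (λ i → indEq j i * g i) ≡⟨ ∑-single _ j (λ i i≢j → cong (_* g i) (indEq-≢ (≢-sym i≢j))) ⟩
    indEq j j * g j           ≡⟨ cong (_* g j) (indEq-refl j) ⟩
    1 * g j                   ≡⟨ *-identityˡ (g j) ⟩
    g j                       ∎

∑-count : (t : Test n k) → ∑ (count t) ≡ n
∑-count {n} t = begin
  ∑ (count t)             ≡⟨ ∑-cong (λ i → *-identityʳ (count t i)) ⟨
  ∑ (λ i → count t i * 1) ≡⟨ ∑-fibres t (λ _ → 1) ⟨
  ∑ {n} (λ _ → 1)         ≡⟨ ∑-const {n} 1 ⟩
  n * 1                   ≡⟨ *-identityʳ n ⟩
  n                       ∎
  where open ≡-Reasoning

separatedPairs : Test n k → ℕ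
separatedPairs t = ∑ λ s → ∑ λ s' → indLt (t s) (t s')

separatedPairs-identity : (t : Test n k) →
  separatedPairs t + separatedPairs t + ∑ (λ i → count t i * count t i) ≡ n * n
separatedPairs-identity {n} t = begin
  D + D + ∑ (λ i → count t i * count t i)
    ≡⟨ cong₂ (λ x y → D + x + y) (∑-comm (λ s s' → lt s s')) (sym (∑-fibres t (count t))) ⟩
  ∑ (λ s → ∑ λ s' → lt s s') + ∑ (λ s → ∑ λ s' → lt s' s) + ∑ (λ s → count t (t s))
    ≡⟨ ∑-distrib-+₃ (λ s → ∑ λ s' → lt s s') (λ s → ∑ λ s' → lt s' s) (λ s → count t (t s)) ⟨
  ∑ (λ s → ∑ (λ s' → lt s s') + ∑ (λ s' → lt s' s) + count t (t s))
    ≡⟨ ∑-cong (λ s → ∑-distrib-+₃ (λ s' → lt s s') (λ s' → lt s' s) (λ s' → indEq (t s') (t s))) ⟨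
  ∑ (λ s → ∑ (λ s' → lt s s' + lt s' s + indEq (t s') (t s)))
    ≡⟨ ∑-cong (λ s → ∑-cong (λ s' → indLt-trichotomy (t s) (t s'))) ⟩
  ∑ {n} (λ s → ∑ {n} (λ s' → 1))
    ≡⟨ ∑-cong {n} (λ s → trans (∑-const {n} 1) (*-identityʳ n)) ⟩
  ∑ {n} (λ s → n)
    ≡⟨ ∑-const {n} n ⟩
  n * n ∎
  where
  open ≡-Reasoning
  D = separatedPairs t
  lt : Fin n → Fin n → ℕ
  lt s s' = indLt (t s) (t s')

∑-mul-complement : (c : Fin k → ℕ) → ∑ c ≡ n →
  ∑ (λ i → c i * (n ∸ c i)) + ∑ (λ i → c i * c i) ≡ n * n
∑-mul-complement {n = n} c ∑c≡n = begin
  ∑ (λ i → c i * (n ∸ c i)) + ∑ (λ i → c i * c i) ≡⟨ ∑-distrib-+ (λ i → c i * (n ∸ c i)) _ ⟨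
  ∑ (λ i → c i * (n ∸ c i) + c i * c i)           ≡⟨ ∑-cong complement ⟩
  ∑ (λ i → c i * n)                               ≡⟨ ∑-distribʳ-* c n ⟨
  ∑ c * n                                         ≡⟨ cong (_* n) ∑c≡n ⟩
  n * n                                           ∎
  where
  open ≡-Reasoning
  complement : ∀ i → c i * (n ∸ c i) + c i * c i ≡ c i * n
  complement i = trans (sym (*-distribˡ-+ (c i) (n ∸ c i) (c i)))
                       (cong (c i *_) (m∸n+n≡m (subst (c i ≤_) ∑c≡n (≤-∑ c i))))

2*separatedPairs : (t : Test n k) → 2 * separatedPairs t ≡ ∑ (λ i → count t i * (n ∸ count t i))
2*separatedPairs {n} t = +-cancelʳ-≡ squares _ _ (begin
  2 * D + squares                                ≡⟨ cong (λ x → D + x + squares) (+-identityʳ D) ⟩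
  D + D + squares                                ≡⟨ separatedPairs-identity t ⟩
  n * n                                          ≡⟨ ∑-mul-complement (count t) (∑-count t) ⟨
  ∑ (λ i → count t i * (n ∸ count t i)) + squares ∎)
  where
  open ≡-Reasoning
  D = separatedPairs t
  squares = ∑ (λ i → count t i * count t i)

count-++ : (t : Test m k) (u : Test n k) (i : Fin k) → count (t ++ u) i ≡ count t i + count u i
count-++ {m} t u i = trans (∑-splitAt {m} (λ s → indEq ((t ++ u) s) i)) (cong₂ _+_
  (∑-cong (λ s → cong (λ c → indEq c i) (lookup-++ˡ t u s)))
  (∑-cong (λ s → cong (λ c → indEq c i) (lookup-++ʳ t u s))))

count-const : (i : Fin k) → count {n} (λ _ → i) i ≡ n
count-const {n = n} i = trans (∑-cong {n} (λ _ → indEq-refl i)) (trans (∑-const {n} 1) (*-identityʳ n))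

count-∉ : (t : Test n k) (i : Fin k) → (∀ s → t s ≢ i) → count t i ≡ 0
count-∉ {n} t i t≢i = trans (∑-cong (λ s → indEq-≢ (t≢i s))) (trans (∑-const {n} 0) (*-zeroʳ n))

count-∘-injective : (f : Fin k → Fin m) → Injective _≡_ _≡_ f → (t : Test n k) (i : Fin k) →
  count (f ∘ t) (f i) ≡ count t i
count-∘-injective f f-inj t i = ∑-cong (λ s → indEq-injective f f-inj (t s) i)

test-with-counts : (a : Fin k → ℕ) → ∑ a ≡ n → Σ (Test n k) λ t → ∀ i → count t i ≡ a i
test-with-counts {k} a refl = subst (λ m → Σ (Test m k) λ t → ∀ i → count t i ≡ a i) (sym (∑≡sum a)) (build a)
  where
  build : ∀ {k} (a : Fin k → ℕ) → Σ (Test (Sum.sum a) k) λ t → ∀ i → count t i ≡ a i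
  build {zero}  a = (λ ()) , (λ ())
  build {suc k} a = t , counts
    where
    t' = proj₁ (build (a ∘ suc))
    zeros : Test (a zero) (suc k)
    zeros _ = zero
    t : Test (Sum.sum a) (suc k)
    t = zeros ++ (suc ∘ t')
    counts : ∀ i → count t i ≡ a i
    counts zero = begin
      count t zero                                 ≡⟨ count-++ zeros (suc ∘ t') zero ⟩
      count zeros zero + count (suc ∘ t') zero     ≡⟨ cong₂ _+_ (count-const {k = suc k} {n = a zero} zero)
                                                                 (count-∉ (suc ∘ t') zero (λ _ ())) ⟩
      a zero + 0                                   ≡⟨ +-identityʳ (a zero) ⟩
      a zero                                       ∎
      where open ≡-Reasoning
    counts (suc i) = begin
      count t (suc i)                              ≡⟨ count-++ zeros (suc ∘ t') (suc i) ⟩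
      count zeros (suc i) + count (suc ∘ t') (suc i) ≡⟨ cong₂ _+_ (count-∉ zeros (suc i) (λ _ ()))
                                                                   (count-∘-injective suc suc-injective t' i) ⟩
      count t' i                                   ≡⟨ proj₂ (build (a ∘ suc)) i ⟩
      a (suc i)                                    ∎
      where open ≡-Reasoning

punchIn-or-self : (i j : Fin (suc n)) → j ≡ i ⊎ ∃ λ x → punchIn i x ≡ j
punchIn-or-self i j with i ≟ j
... | yes i≡j = inj₁ (sym i≡j)
... | no  i≢j = inj₂ (punchOut i≢j , punchIn-punchOut i≢j)

insert-self : (i : Fin (suc m)) (j : Fin (suc n)) (π : Permutation m n) → insert i j π ⟨$⟩ʳ i ≡ j
insert-self i j π with i ≟ i
... | yes _   = refl
... | no  i≢i = contradiction refl i≢i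

module Sorting {c ℓ₁ ℓ₂} (O : DecTotalOrder c ℓ₁ ℓ₂) where

  open DecTotalOrder O renaming (Carrier to A; _≤_ to _≼_; _≤?_ to _≼?_)
  open import Data.List.Extrema totalOrder using (argmin; f[argmin]≤f[xs])

  Sorts : (Fin n → A) → Permutation′ n → Set ℓ₂
  Sorts f π = ∀ s s' → ¬ f s' ≼ f s → π ⟨$⟩ʳ s < π ⟨$⟩ʳ s'

  sort : (f : Fin n → A) → Σ (Permutation′ n) (Sorts f)
  sort {zero}  f = Perm.id , λ ()
  sort {suc n} f = insert least zero π , sorts
    where
    least : Fin (suc n)
    least = argmin f zero (allFin (suc n))
    least-minimal : ∀ s → f least ≼ f s
    least-minimal s = All.lookup (f[argmin]≤f[xs] zero (allFin (suc n))) (∈-allFin s)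
    π = proj₁ (sort (f ∘ punchIn least))
    rank-punchIn : ∀ x → insert least zero π ⟨$⟩ʳ punchIn least x ≡ suc (π ⟨$⟩ʳ x)
    rank-punchIn = insert-punchIn least zero π
    sorts : Sorts f (insert least zero π)
    sorts s s' fs'⋠fs with punchIn-or-self least s | punchIn-or-self least s'
    ... | _                | inj₁ refl         = contradiction (least-minimal s) fs'⋠fs
    ... | inj₁ refl        | inj₂ (x' , refl)  =
      subst₂ _<_ (sym (insert-self least zero π)) (sym (rank-punchIn x')) z<s
    ... | inj₂ (x , refl)  | inj₂ (x' , refl)  =
      subst₂ _<_ (sym (rank-punchIn x)) (sym (rank-punchIn x')) (s<s (proj₂ (sort (f ∘ punchIn least)) x x' fs'⋠fs))

  sorted-≼ : (f : Fin n → A) (π : Permutation′ n) → Sorts f π →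
             ∀ s s' → π ⟨$⟩ʳ s < π ⟨$⟩ʳ s' → f s ≼ f s'
  sorted-≼ f π π-sorts s s' πs<πs' with f s ≼? f s'
  ... | yes fs≼fs' = fs≼fs'
  ... | no  fs⋠fs' = contradiction (π-sorts s' s fs⋠fs') (<-asym πs<πs')

lex : (k m : ℕ) → DecTotalOrder _ _ _
lex k m = ×-decTotalOrder (≤-decTotalOrder k) (≤-decTotalOrder m)

module _ {k m : ℕ} where
  open DecTotalOrder (lex k m) using () renaming (_≤_ to _≤lex_)

  ≤lex⇒≯₁ : {x₁ y₁ : Fin k} {x₂ y₂ : Fin m} → (x₁ , x₂) ≤lex (y₁ , y₂) → ¬ y₁ < x₁
  ≤lex⇒≯₁ (inj₁ (x₁≤y₁ , _)) y₁<x₁ = <⇒≱ y₁<x₁ x₁≤y₁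
  ≤lex⇒≯₁ (inj₂ (refl , _))  y₁<x₁ = <-irrefl refl y₁<x₁

  ≤lex∧>₂⇒<₁ : {x₁ y₁ : Fin k} {x₂ y₂ : Fin m} → (x₁ , x₂) ≤lex (y₁ , y₂) → y₂ < x₂ → x₁ < y₁
  ≤lex∧>₂⇒<₁ (inj₁ (x₁≤y₁ , x₁≢y₁)) _     = ≤∧≢⇒< x₁≤y₁ x₁≢y₁
  ≤lex∧>₂⇒<₁ (inj₂ (_ , x₂≤y₂))    y₂<x₂ = contradiction x₂≤y₂ (<⇒≱ y₂<x₂)

-- The first panel is sorted by (t₁ , t₂), the second by t₂ with ties broken by the position in the
-- first panel; so a pair ordered differently in the two panels must be separated by t₁.
sortedLayout : (t₁ t₂ : Test n k) → Σ (Layout t₁ t₂) λ L →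
  ∀ s s' → s precedes s' under π₁ L → s' precedes s under π₂ L → t₁ s < t₁ s'
sortedLayout {n} {k} t₁ t₂ = layout , crossing
  where
  module S₁ = Sorting (lex k k)
  module S₂ = Sorting (lex k n)
  key₁ : Fin n → Fin k × Fin k
  key₁ s = t₁ s , t₂ s
  sorted₁ = S₁.sort key₁
  ρ₁ = proj₁ sorted₁
  key₂ : Fin n → Fin k × Fin n
  key₂ s = t₂ s , ρ₁ ⟨$⟩ʳ s
  sorted₂ = S₂.sort key₂
  ρ₂ = proj₁ sorted₂
  layout : Layout t₁ t₂
  layout = record
    { π₁ = ρ₁
    ; π₂ = ρ₂
    ; resp₁ = λ s s' t₁s<t₁s' → proj₂ sorted₁ s s' (λ key≤ → ≤lex⇒≯₁ key≤ t₁s<t₁s')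
    ; resp₂ = λ s s' t₂s<t₂s' → proj₂ sorted₂ s s' (λ key≤ → ≤lex⇒≯₁ key≤ t₂s<t₂s')
    }
  crossing : ∀ s s' → s precedes s' under ρ₁ → s' precedes s under ρ₂ → t₁ s < t₁ s'
  crossing s s' ρ₁s<ρ₁s' ρ₂s'<ρ₂s =
    ≤lex∧>₂⇒<₁ (S₁.sorted-≼ key₁ ρ₁ (proj₂ sorted₁) s s' ρ₁s<ρ₁s')
               (≤lex∧>₂⇒<₁ (S₂.sorted-≼ key₂ ρ₂ (proj₂ sorted₂) s' s ρ₂s'<ρ₂s) ρ₁s<ρ₁s')

crossInd-≡1 : {π₁ π₂ : LinOrder n} {s s' : Fin n} →
  s precedes s' under π₁ → s' precedes s under π₂ → crossInd π₁ π₂ s s' ≡ 1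
crossInd-≡1 {π₁ = π₁} {π₂} {s} {s'} p₁ p₂
  with (π₁ ⟨$⟩ʳ s) <? (π₁ ⟨$⟩ʳ s') | (π₂ ⟨$⟩ʳ s') <? (π₂ ⟨$⟩ʳ s)
... | yes _  | yes _  = refl
... | no ¬p₁ | _      = contradiction p₁ ¬p₁
... | yes _  | no ¬p₂ = contradiction p₂ ¬p₂

crossInd≤indLt : {π₁ π₂ : LinOrder n} {s s' : Fin n} {i j : Fin k} →
  (s precedes s' under π₁ → s' precedes s under π₂ → i < j) → crossInd π₁ π₂ s s' ≤ indLt i j
crossInd≤indLt {π₁ = π₁} {π₂} {s} {s'} crossing⇒i<j
  with (π₁ ⟨$⟩ʳ s) <? (π₁ ⟨$⟩ʳ s') | (π₂ ⟨$⟩ʳ s') <? (π₂ ⟨$⟩ʳ s)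
... | yes p₁ | yes p₂ = ≤-reflexive (sym (indLt-< (crossing⇒i<j p₁ p₂)))
... | yes _  | no  _  = z≤n
... | no  _  | _      = z≤n

indLt≤crossInd : {π₁ π₂ : LinOrder n} {s s' : Fin n} {i j : Fin k} →
  (i < j → s precedes s' under π₁ × s' precedes s under π₂) → indLt i j ≤ crossInd π₁ π₂ s s'
indLt≤crossInd {i = i} {j} i<j⇒crossing with i <? j
... | yes i<j = ≤-reflexive (sym (uncurry crossInd-≡1 (i<j⇒crossing i<j)))
... | no  _   = z≤n

crossings-sortedLayout : (t₁ t₂ : Test n k) → crossings (proj₁ (sortedLayout t₁ t₂)) ≤ separatedPairs t₁
crossings-sortedLayout t₁ t₂ = ∑-mono λ s → ∑-mono λ s' → crossInd≤indLt (proj₂ (sortedLayout t₁ t₂) s s')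

pcr≤separatedPairs : {t₁ t₂ : Test n k} {p : ℕ} → IsPcr t₁ t₂ p → p ≤ separatedPairs t₁
pcr≤separatedPairs {t₁ = t₁} {t₂} (_ , minimal) =
  ≤-trans (minimal (proj₁ (sortedLayout t₁ t₂))) (crossings-sortedLayout t₁ t₂)

opposite-< : {i j : Fin k} → i < j → opposite j < opposite i
opposite-< {i = i} {j} i<j =
  subst₂ ℕ._<_ (sym (opposite-prop j)) (sym (opposite-prop i)) (∸-monoʳ-< (s<s i<j) (toℕ<n j))

opposite-injective : Injective _≡_ _≡_ (opposite {k})
opposite-injective {x = x} {y} ox≡oy = begin
  x                       ≡⟨ opposite-involutive x ⟨
  opposite (opposite x)   ≡⟨ cong opposite ox≡oy ⟩
  opposite (opposite y)   ≡⟨ opposite-involutive y ⟩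
  y                       ∎
  where open ≡-Reasoning

separatedPairs≤crossings : (t : Test n k) (L : Layout t (opposite ∘ t)) → separatedPairs t ≤ crossings L
separatedPairs≤crossings t L = ∑-mono λ s → ∑-mono λ s' →
  indLt≤crossInd (λ ts<ts' → resp₁ L s s' ts<ts' , resp₂ L s' s (opposite-< ts<ts'))

isPcr-opposite : (t : Test n k) → IsPcr t (opposite ∘ t) (separatedPairs t)
isPcr-opposite t = (L , ≤-antisym (crossings-sortedLayout t (opposite ∘ t)) (separatedPairs≤crossings t L))
                 , separatedPairs≤crossings t
  where L = proj₁ (sortedLayout t (opposite ∘ t))

lemma4 : (n k : ℕ) (a : Fin k → ℕ) → ∑ a ≡ n →
    Σ ℕ λ m →
      IsEcr (InT {n} {k} a) m
      × 2 * m ≡ ∑ (λ i → a i * (n ∸ a i))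
      × (Σ (Test n k) λ t₁ → Σ (Test n k) λ t₂ →
           InT a t₁ t₂
           × (∀ i → count t₁ i ≡ count t₂ (opposite i))
           × IsPcr t₁ t₂ m)
lemma4 n k a ∑a≡n =
  separatedPairs t , ((t , t̄ , t-counts , isPcr-opposite t) , maximal) , 2*pairs-InT t t-counts
                   , (t , t̄ , t-counts , mirrored , isPcr-opposite t)
  where
  t = proj₁ (test-with-counts a ∑a≡n)
  t-counts = proj₂ (test-with-counts a ∑a≡n)
  t̄ = opposite ∘ t
  2*pairs-InT : (t₁ : Test n k) → (∀ i → count t₁ i ≡ a i) →
                2 * separatedPairs t₁ ≡ ∑ (λ i → a i * (n ∸ a i))
  2*pairs-InT t₁ counts = trans (2*separatedPairs t₁) (∑-cong (λ i → cong (λ c → c * (n ∸ c)) (counts i)))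
  maximal : ∀ t₁ t₂ → InT a t₁ t₂ → ∀ p → IsPcr t₁ t₂ p → p ≤ separatedPairs t
  maximal t₁ t₂ counts p pcr = ≤-trans (pcr≤separatedPairs pcr)
    (≤-reflexive (*-cancelˡ-≡ _ _ 2 (trans (2*pairs-InT t₁ counts) (sym (2*pairs-InT t t-counts)))))
  mirrored : ∀ i → count t i ≡ count t̄ (opposite i)
  mirrored i = sym (count-∘-injective opposite opposite-injective t i)
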